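{- Let $T_1$ be an $(r\times c_1, v_1)$-near triple array and $T_2$ an $(r\times c_2, v_2)$-near triple array on disjoint sets of symbols, with parameters $e_1,\lambda^1_{rr},\lambda^1_{cc},\lambda^1_{rc}$ and $e_2,\lambda^2_{rr},\lambda^2_{cc},\lambda^2_{rc}$ respectively. Suppose that (1) $\max(e_1^+, e_2^+) - \min(e_1^-, e_2^-) \le 1$; (2) $\lambda^1_{rr}\in\mathbb{Z}$ or $\lambda^2_{rr}\in\mathbb{Z}$; (3) $\lambda^1_{cc}\le 1$ and $\lambda^2_{cc}\le 1$. Let $T$ be the $r\times(c_1+c_2)$ array whose $i$-th row is the concatenation of the $i$-th row of $T_1$ followed by the $i$-th row of $T_2$. Then $T$ is an $(r\times(c_1+c_2), v_1+v_2)$-near triple array.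
   Context: Here $e_i = rc_i/v_i$, $e_i^-=\lfloor e_i\rfloor$, $e_i^+=\lceil e_i\rceil$. An $r\times c$ row-column design on $v$ symbols is an $r\times c$ array each of whose cells is filled with one of $v$ symbols. It is binary if no symbol occurs more than once in any row or in any column. Let $e=rc/v$, $e^-=\lfloor e\rfloor$, $e^+=\lceil e\rceil$. The design is equireplicate if $e$ is an integer and every symbol occurs exactly $e$ times, and near equireplicate if $e$ is not an integer and every symbol occurs $e^-$ or $e^+$ times. For a binary design with $r,c\ge2$, let $R_i$, $C_j$ be the symbol sets of row $i$ and column $j$, and put $\lambda_{rc}=\frac{1}{rc}\sum_{i,j}|R_i\cap C_j|$, $\lambda_{rr}=\binom{r}{2}^{ -1}\sum_{i<j}|R_i\cap R_j|$, $\lambda_{cc}=\binom{c}{2}^{ -1}\sum_{i<j}|C_i\cap C_j|$ (these are the parameters of the design); for real $x$, $x^-=\lfloor x\rfloor$, $x^+=\lceil x\rceil$. An $(r\times c,v)$-near triple array is a binary $r\times c$ row-column design on $v$ symbols which is equireplicate or near equireplicate and in which every row and column share $\lambda_{rc}^-$ or $\lambda_{rc}^+$ symbols, every two distinct rows share $\lambda_{rr}^-$ or $\lambda_{rr}^+$ symbols, and every two distinct columns share $\lambda_{cc}^-$ or $\lambda_{cc}^+$ symbols. -}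

module Defs where

open import Data.Nat using (ℕ; zero; suc; _+_; _*_; _≤_; _<ᵇ_)
open import Data.Nat.DivMod using (_/_)
open import Data.Nat.Combinatorics using (_C_)
open import Data.Bool using (Bool; true; false; if_then_else_; _∧_; _∨_)
open import Data.Fin using (Fin; zero; suc; toℕ; _≟_; _↑ˡ_; _↑ʳ_; splitAt)
open import Data.Sum using (_⊎_; [_,_]′)
open import Data.Product using (_×_)
open import Relation.Nullary using (¬_)
open import Relation.Nullary.Decidable using (isYes)
open import Relation.Binary.PropositionalEquality using (_≡_; _≢_)

Design : ℕ → ℕ → ℕ → Set
Design r c v = Fin r → Fin c → Fin v

eqᵇ : ∀ {v} → Fin v → Fin v → Bool
eqᵇ s t = isYes (s ≟ t)

anyF : ∀ {n} → (Fin n → Bool) → Bool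
anyF {zero} f = false
anyF {suc n} f = f zero ∨ anyF (λ i → f (suc i))

countF : ∀ {n} → (Fin n → Bool) → ℕ
countF {zero} f = 0
countF {suc n} f = (if f zero then 1 else 0) + countF (λ i → f (suc i))

sumF : ∀ {n} → (Fin n → ℕ) → ℕ
sumF {zero} f = 0
sumF {suc n} f = f zero + sumF (λ i → f (suc i))

-- floor and ceiling of a / b (b > 0; value 0 when b = 0, never used)
floorDiv : ℕ → ℕ → ℕ
floorDiv a zero = 0
floorDiv a (suc b) = a / suc b

ceilDiv : ℕ → ℕ → ℕ
ceilDiv a zero = 0
ceilDiv a (suc b) = (a + b) / suc b

FloorOrCeil : ℕ → ℕ → ℕ → Set
FloorOrCeil k a b = k ≡ floorDiv a b ⊎ k ≡ ceilDiv a b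

module _ {r c v : ℕ} (T : Design r c v) where

  inRow : Fin r → Fin v → Bool
  inRow i s = anyF (λ j → eqᵇ (T i j) s)

  inCol : Fin c → Fin v → Bool
  inCol j s = anyF (λ i → eqᵇ (T i j) s)

  repl : Fin v → ℕ
  repl s = sumF (λ i → countF (λ j → eqᵇ (T i j) s))

  rcMeet : Fin r → Fin c → ℕ
  rcMeet i j = countF (λ s → inRow i s ∧ inCol j s)

  rrMeet : Fin r → Fin r → ℕ
  rrMeet i i' = countF (λ s → inRow i s ∧ inRow i' s)

  ccMeet : Fin c → Fin c → ℕ
  ccMeet j j' = countF (λ s → inCol j s ∧ inCol j' s)

  -- numerators of λ_rc, λ_rr, λ_cc
  -- (λ_rc = Src / (r c), λ_rr = Srr / C(r,2), λ_cc = Scc / C(c,2))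
  Src : ℕ
  Src = sumF (λ i → sumF (λ j → rcMeet i j))

  Srr : ℕ
  Srr = sumF (λ i → sumF (λ i' → if toℕ i <ᵇ toℕ i' then rrMeet i i' else 0))

  Scc : ℕ
  Scc = sumF (λ j → sumF (λ j' → if toℕ j <ᵇ toℕ j' then ccMeet j j' else 0))

  Binary : Set
  Binary = (∀ i j j' → T i j ≡ T i j' → j ≡ j')
         × (∀ i i' j → T i j ≡ T i' j → i ≡ i')

  NearEquireplicate : Set
  NearEquireplicate = ∀ s → FloorOrCeil (repl s) (r * c) v

  NearTripleArray : Set
  NearTripleArray =
    2 ≤ r × 2 ≤ c × Binary × NearEquireplicate
    × (∀ i j → FloorOrCeil (rcMeet i j) Src (r * c))
    × (∀ i i' → i ≢ i' → FloorOrCeil (rrMeet i i') Srr (r C 2))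
    × (∀ j j' → j ≢ j' → FloorOrCeil (ccMeet j j') Scc (c C 2))

-- row-wise juxtaposition, T₁'s symbols embedded as the first v₁ of Fin (v₁+v₂),
-- T₂'s symbols as the last v₂ (so the symbol sets are disjoint)
juxtapose : ∀ {r c₁ c₂ v₁ v₂} → Design r c₁ v₁ → Design r c₂ v₂
          → Design r (c₁ + c₂) (v₁ + v₂)
juxtapose {r} {c₁} {c₂} {v₁} {v₂} T₁ T₂ i j =
  [ (λ j₁ → T₁ i j₁ ↑ˡ v₂) , (λ j₂ → v₁ ↑ʳ T₂ i j₂) ]′ (splitAt c₁ j)

{-# OPTIONS --safe #-}
module Submission where

open import Defs
open import Data.Nat using (ℕ; zero; suc; _+_; _*_; _≤_; _<_; _<ᵇ_; z≤n; s≤s; _⊔_; _⊓_; NonZero)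
open import Data.Nat.Properties hiding (_≟_; suc-injective)
open import Data.Nat.DivMod using (_/_; _%_; m≡m%n+[m/n]*n; m%n<n; m<n*o⇒m/o<n; m/n*n≤m; /-monoˡ-≤)
open import Data.Nat.Divisibility using (_∣_; divides)
open import Data.Nat.Combinatorics using (_C_; nC1≡n; nCk+nC[k+1]≡[n+1]C[k+1])
open import Data.Bool using (Bool; true; false; if_then_else_; _∧_; _∨_)
open import Data.Bool.Properties using (∧-comm; ∧-zeroʳ; ∨-identityʳ; ∨-assoc)
open import Data.Fin using (Fin; zero; suc; toℕ; _≟_; _↑ˡ_; _↑ʳ_; splitAt; combine; remQuot; fromℕ<)
open import Data.Fin.Properties
  using ( splitAt-↑ˡ; splitAt-↑ʳ; splitAt⁻¹-↑ˡ; splitAt⁻¹-↑ʳ; ↑ˡ-injective; ↑ʳ-injective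
        ; toℕ-↑ˡ; toℕ-↑ʳ; toℕ<n; toℕ-injective; remQuot-combine; suc-injective )
open import Data.Product using (_×_; _,_; proj₁; proj₂; uncurry)
open import Data.Sum using (_⊎_; inj₁; inj₂)
open import Function using (_∘_)
open import Relation.Nullary using (yes; no; contradiction)
open import Relation.Binary.Definitions using (tri<; tri≈; tri>)
open import Relation.Binary.PropositionalEquality
open import Algebra.Properties.CommutativeSemigroup +-commutativeSemigroup using (interchange)

-- Put m = min ⌊e₁⌋ ⌊e₂⌋. By (1) every replication number of T₁ and of T₂ is m or m + 1. In a
-- binary design Σ_{i,j} |R_i ∩ C_j| = Σ_s (replication of s)², so λ_rc lies in [m, m + 1] and
-- every row-column intersection of T₁ and T₂ is m or m + 1 as well. Juxtaposition keeps
-- replication numbers and row-column intersections, and naturals that all lie in {m, m + 1}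
-- are floors or ceilings of their mean. Row intersections of T are sums of those of T₁ and T₂,
-- and adding a family whose mean is an integer (2) preserves being a floor or ceiling of the
-- mean. By (3) two columns inside T₁ or inside T₂ share at most one symbol, while columns from
-- different blocks share none; hence λ_cc of T is below 1 and every column intersection, being
-- 0 or 1, is its floor or ceiling.

Between : ℕ → ℕ → ℕ → Set
Between lo hi x = lo ≤ x × x ≤ hi

NearQuotient : ℕ → ℕ → ℕ → Set
NearQuotient x S N = S < suc x * N × x * N < S + N

m<[1+m/n]*n : ∀ m n .{{_ : NonZero n}} → m < suc (m / n) * n
m<[1+m/n]*n m n = begin-strict
  m                  ≡⟨ m≡m%n+[m/n]*n m n ⟩
  m % n + m / n * n  <⟨ +-monoˡ-< (m / n * n) (m%n<n m n) ⟩
  n + m / n * n      ∎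
  where open ≤-Reasoning

/-unique : ∀ {x S} n .{{_ : NonZero n}} → x * n ≤ S → S < suc x * n → S / n ≡ x
/-unique {x} {S} n xn≤S S<[1+x]n = ≤-antisym
  (m<1+n⇒m≤n (m<n*o⇒m/o<n S<[1+x]n))
  (m<1+n⇒m≤n (*-cancelʳ-< n x (suc (S / n)) (≤-<-trans xn≤S (m<[1+m/n]*n S n))))

nearQuotient⇒floorOrCeil : ∀ {x S N} → NearQuotient x S N → FloorOrCeil x S N
nearQuotient⇒floorOrCeil {x} {S} {zero} (S<0 , _) = contradiction (subst (S <_) (*-zeroʳ x) S<0) n≮0
nearQuotient⇒floorOrCeil {x} {S} {N@(suc n)} (S<[1+x]N , xN<S+N) with x * N ≤? S
... | yes xN≤S = inj₁ (sym (/-unique N xN≤S S<[1+x]N))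
... | no  xN≰S = inj₂ (sym (/-unique N xN≤S+n S+n<[1+x]N))
  where
  xN≤S+n : x * N ≤ S + n
  xN≤S+n = m<1+n⇒m≤n (subst (x * N <_) (+-suc S n) xN<S+N)
  S+n<[1+x]N : S + n < suc x * N
  S+n<[1+x]N = begin-strict
    S + n      ≡⟨ +-comm S n ⟩
    n + S      <⟨ +-monoʳ-< n (≰⇒> xN≰S) ⟩
    n + x * N  <⟨ n<1+n _ ⟩
    N + x * N  ∎
    where open ≤-Reasoning

floorOrCeil⇒nearQuotient : ∀ {x S N} → 0 < N → FloorOrCeil x S N → NearQuotient x S N
floorOrCeil⇒nearQuotient {S = S} {N@(suc n)} _ (inj₁ refl) =
  m<[1+m/n]*n S N , ≤-<-trans (m/n*n≤m S N) (m<m+n S (s≤s z≤n))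
floorOrCeil⇒nearQuotient {S = S} {N@(suc n)} _ (inj₂ refl) =
  ≤-<-trans (m≤m+n S n) (m<[1+m/n]*n (S + n) N) ,
  ≤-<-trans (m/n*n≤m (S + n) N) (+-monoʳ-< S (n<1+n n))

floorDiv≤ceilDiv : ∀ S N → floorDiv S N ≤ ceilDiv S N
floorDiv≤ceilDiv S zero    = z≤n
floorDiv≤ceilDiv S (suc n) = /-monoˡ-≤ (suc n) (m≤m+n S n)

floorOrCeil-between : ∀ {x lo hi} S N → lo ≤ floorDiv S N → ceilDiv S N ≤ hi
                    → FloorOrCeil x S N → Between lo hi x
floorOrCeil-between S N lo≤⌊S/N⌋ ⌈S/N⌉≤hi (inj₁ refl) =
  lo≤⌊S/N⌋ , ≤-trans (floorDiv≤ceilDiv S N) ⌈S/N⌉≤hi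
floorOrCeil-between S N lo≤⌊S/N⌋ ⌈S/N⌉≤hi (inj₂ refl) =
  ≤-trans lo≤⌊S/N⌋ (floorDiv≤ceilDiv S N) , ⌈S/N⌉≤hi

floorOrCeil-within : ∀ {x S N} m → 0 < N → m * N ≤ S → S ≤ suc m * N
                   → FloorOrCeil x S N → Between m (suc m) x
floorOrCeil-within {x} {S} {N} m N>0 mN≤S S≤[1+m]N fc =
  m<1+n⇒m≤n (*-cancelʳ-< N m (suc x) (≤-<-trans mN≤S (proj₁ near))) ,
  m<1+n⇒m≤n (*-cancelʳ-< N x (suc (suc m)) xN<[2+m]N)
  where
  near : NearQuotient x S N
  near = floorOrCeil⇒nearQuotient N>0 fc
  xN<[2+m]N : x * N < suc (suc m) * N
  xN<[2+m]N = begin-strict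
    x * N          <⟨ proj₂ near ⟩
    S + N          ≤⟨ +-monoˡ-≤ N S≤[1+m]N ⟩
    suc m * N + N  ≡⟨ +-comm (suc m * N) N ⟩
    N + suc m * N  ∎
    where open ≤-Reasoning

floorOrCeil-exact : ∀ {x S N} → 0 < N → N ∣ S → FloorOrCeil x S N → x * N ≡ S
floorOrCeil-exact {x} {N = N} N>0 (divides k refl) fc = cong (_* N) (≤-antisym
  (m<1+n⇒m≤n (*-cancelʳ-< N x (suc k) (subst (x * N <_) (+-comm (k * N) N) (proj₂ near))))
  (m<1+n⇒m≤n (*-cancelʳ-< N k (suc x) (proj₁ near))))
  where
  near : NearQuotient x (k * N) N
  near = floorOrCeil⇒nearQuotient N>0 fc

floorOrCeil-+-multiple : ∀ {x y S N} → 0 < N → FloorOrCeil y S N → FloorOrCeil (x + y) (x * N + S) N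
floorOrCeil-+-multiple {x} {y} {S} {N} N>0 fc = nearQuotient⇒floorOrCeil (upper , lower)
  where
  open ≤-Reasoning
  near : NearQuotient y S N
  near = floorOrCeil⇒nearQuotient N>0 fc
  upper : x * N + S < suc (x + y) * N
  upper = begin-strict
    x * N + S          <⟨ +-monoʳ-< (x * N) (proj₁ near) ⟩
    x * N + suc y * N  ≡⟨ *-distribʳ-+ N x (suc y) ⟨
    (x + suc y) * N    ≡⟨ cong (_* N) (+-suc x y) ⟩
    suc (x + y) * N    ∎
  lower : (x + y) * N < x * N + S + N
  lower = begin-strict
    (x + y) * N        ≡⟨ *-distribʳ-+ N x y ⟩
    x * N + y * N      <⟨ +-monoʳ-< (x * N) (proj₂ near) ⟩
    x * N + (S + N)    ≡⟨ +-assoc (x * N) S N ⟨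
    x * N + S + N      ∎

floorOrCeil-+-divisible : ∀ {x y S₁ S₂ N} → 0 < N → N ∣ S₁
                        → FloorOrCeil x S₁ N → FloorOrCeil y S₂ N → FloorOrCeil (x + y) (S₁ + S₂) N
floorOrCeil-+-divisible {x} {y} {S₁} {S₂} {N} N>0 N∣S₁ fx fy =
  subst (λ S → FloorOrCeil (x + y) (S + S₂) N) (floorOrCeil-exact N>0 N∣S₁ fx) (floorOrCeil-+-multiple N>0 fy)

floorOrCeil-+ : ∀ {x y S₁ S₂ N} → 0 < N → N ∣ S₁ ⊎ N ∣ S₂
              → FloorOrCeil x S₁ N → FloorOrCeil y S₂ N → FloorOrCeil (x + y) (S₁ + S₂) N
floorOrCeil-+ N>0 (inj₁ N∣S₁) fx fy = floorOrCeil-+-divisible N>0 N∣S₁ fx fy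
floorOrCeil-+ {x} {y} {S₁} {S₂} {N} N>0 (inj₂ N∣S₂) fx fy =
  subst₂ (λ z S → FloorOrCeil z S N) (+-comm y x) (+-comm S₂ S₁) (floorOrCeil-+-divisible N>0 N∣S₂ fy fx)

floorOrCeil-≤1 : ∀ {x S N} → x ≤ 1 → x ≤ S → S < N → FloorOrCeil x S N
floorOrCeil-≤1 {S = S} {N} z≤n _ S<N = nearQuotient⇒floorOrCeil
  (subst (S <_) (sym (+-identityʳ N)) S<N , <-≤-trans (≤-<-trans z≤n S<N) (m≤n+m N S))
floorOrCeil-≤1 {S = S} {N} (s≤s z≤n) 1≤S S<N = nearQuotient⇒floorOrCeil
  (<-≤-trans S<N (m≤m+n N _) , subst (_< S + N) (sym (+-identityʳ N)) (+-monoˡ-< N 1≤S))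

sumF-cong : ∀ {n} {f g : Fin n → ℕ} → (∀ k → f k ≡ g k) → sumF f ≡ sumF g
sumF-cong {zero}  f≗g = refl
sumF-cong {suc n} f≗g = cong₂ _+_ (f≗g zero) (sumF-cong (f≗g ∘ suc))

sumF-const : ∀ n a → sumF {n} (λ _ → a) ≡ n * a
sumF-const zero    a = refl
sumF-const (suc n) a = cong (a +_) (sumF-const n a)

sumF-+ : ∀ {n} (f g : Fin n → ℕ) → sumF (λ k → f k + g k) ≡ sumF f + sumF g
sumF-+ {zero}  f g = refl
sumF-+ {suc n} f g = trans (cong (f zero + g zero +_) (sumF-+ (f ∘ suc) (g ∘ suc)))
                           (interchange (f zero) (g zero) (sumF (f ∘ suc)) (sumF (g ∘ suc)))

sumF-*ˡ : ∀ {n} a (f : Fin n → ℕ) → sumF (λ k → a * f k) ≡ a * sumF f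
sumF-*ˡ {zero}  a f = sym (*-zeroʳ a)
sumF-*ˡ {suc n} a f = trans (cong (a * f zero +_) (sumF-*ˡ a (f ∘ suc))) (sym (*-distribˡ-+ a (f zero) _))

sumF-*ʳ : ∀ {n} a (f : Fin n → ℕ) → sumF (λ k → f k * a) ≡ sumF f * a
sumF-*ʳ {zero}  a f = refl
sumF-*ʳ {suc n} a f = trans (cong (f zero * a +_) (sumF-*ʳ a (f ∘ suc))) (sym (*-distribʳ-+ a (f zero) _))

sumF-swap : ∀ {m n} (f : Fin m → Fin n → ℕ) → sumF (λ i → sumF (f i)) ≡ sumF (λ j → sumF (λ i → f i j))
sumF-swap {zero}  {n} f = sym (trans (sumF-const n 0) (*-zeroʳ n))
sumF-swap {suc m} {n} f = trans (cong (sumF (f zero) +_) (sumF-swap (f ∘ suc))) (sym (sumF-+ (f zero) _))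

sumF-product : ∀ {m n} (f : Fin m → ℕ) (g : Fin n → ℕ)
             → sumF (λ i → sumF (λ j → f i * g j)) ≡ sumF f * sumF g
sumF-product f g = trans (sumF-cong (λ i → sumF-*ˡ (f i) g)) (sumF-*ʳ (sumF g) f)

sumF-↑ : ∀ {m n} (f : Fin (m + n) → ℕ) → sumF f ≡ sumF (f ∘ (_↑ˡ n)) + sumF (f ∘ (m ↑ʳ_))
sumF-↑ {zero}      f = refl
sumF-↑ {suc m} {n} f = trans (cong (f zero +_) (sumF-↑ {m} (f ∘ suc))) (sym (+-assoc (f zero) _ _))

sumF-combine : ∀ {m n} (f : Fin (m * n) → ℕ) → sumF f ≡ sumF {m} (λ i → sumF {n} (λ j → f (combine i j)))
sumF-combine {zero}      f = refl
sumF-combine {suc m} {n} f =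
  trans (sumF-↑ {n} f) (cong (sumF (λ j → f (j ↑ˡ m * n)) +_) (sumF-combine {m} (f ∘ (n ↑ʳ_))))

sumF-mono-≤ : ∀ {n} {f g : Fin n → ℕ} → (∀ k → f k ≤ g k) → sumF f ≤ sumF g
sumF-mono-≤ {zero}  f≤g = z≤n
sumF-mono-≤ {suc n} f≤g = +-mono-≤ (f≤g zero) (sumF-mono-≤ (f≤g ∘ suc))

sumF-mono-< : ∀ {n} {f g : Fin n → ℕ} → (∀ k → f k ≤ g k) → ∀ k → f k < g k → sumF f < sumF g
sumF-mono-< f≤g zero    fk<gk = +-mono-<-≤ fk<gk (sumF-mono-≤ (f≤g ∘ suc))
sumF-mono-< f≤g (suc k) fk<gk = +-mono-≤-< (f≤g zero) (sumF-mono-< (f≤g ∘ suc) k fk<gk)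

≤-sumF : ∀ {n} (f : Fin n → ℕ) k → f k ≤ sumF f
≤-sumF f zero    = m≤m+n _ _
≤-sumF f (suc k) = ≤-trans (≤-sumF (f ∘ suc) k) (m≤n+m _ _)

floorOrCeil-mean : ∀ {n} (f : Fin n → ℕ) m → (∀ k → Between m (suc m) (f k))
                 → ∀ k → FloorOrCeil (f k) (sumF f) n
floorOrCeil-mean {n} f m f∈ k = nearQuotient⇒floorOrCeil (upper , lower)
  where
  open ≤-Reasoning
  upper : sumF f < suc (f k) * n
  upper = begin-strict
    sumF f                       <⟨ sumF-mono-< (λ j → ≤-trans (proj₂ (f∈ j)) (s≤s (proj₁ (f∈ k))))
                                                k (n<1+n (f k)) ⟩
    sumF {n} (λ _ → suc (f k))   ≡⟨ sumF-const n (suc (f k)) ⟩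
    n * suc (f k)                ≡⟨ *-comm n _ ⟩
    suc (f k) * n                ∎
  lower : f k * n < sumF f + n
  lower = begin-strict
    f k * n                      ≡⟨ *-comm (f k) n ⟩
    n * f k                      ≡⟨ sumF-const n (f k) ⟨
    sumF {n} (λ _ → f k)         <⟨ sumF-mono-< (λ j → ≤-trans (proj₂ (f∈ k)) (s≤s (proj₁ (f∈ j))))
                                                k (n<1+n (f k)) ⟩
    sumF (λ j → 1 + f j)         ≡⟨ sumF-+ (λ _ → 1) f ⟩
    sumF {n} (λ _ → 1) + sumF f  ≡⟨ cong (_+ sumF f) (trans (sumF-const n 1) (*-identityʳ n)) ⟩
    n + sumF f                   ≡⟨ +-comm n _ ⟩
    sumF f + n                   ∎

floorOrCeil-mean₂ : ∀ {a b} (f : Fin a → Fin b → ℕ) m → (∀ i j → Between m (suc m) (f i j))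
                  → ∀ i j → FloorOrCeil (f i j) (sumF (λ i → sumF (f i))) (a * b)
floorOrCeil-mean₂ {a} {b} f m f∈ i j =
  subst₂ (λ x S → FloorOrCeil x S (a * b)) (g-combine i j) Σg≡Σf
    (floorOrCeil-mean g m (λ k → f∈ (proj₁ (remQuot {a} b k)) (proj₂ (remQuot {a} b k))) (combine i j))
  where
  g : Fin (a * b) → ℕ
  g = uncurry f ∘ remQuot {a} b
  g-combine : ∀ i j → g (combine i j) ≡ f i j
  g-combine i j = cong (uncurry f) (remQuot-combine i j)
  Σg≡Σf : sumF g ≡ sumF (λ i → sumF (f i))
  Σg≡Σf = trans (sumF-combine {a} g) (sumF-cong (λ i → sumF-cong (g-combine i)))

𝟙 : Bool → ℕ
𝟙 b = if b then 1 else 0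

𝟙-∧ : ∀ a b → 𝟙 (a ∧ b) ≡ 𝟙 a * 𝟙 b
𝟙-∧ true  b = sym (+-identityʳ (𝟙 b))
𝟙-∧ false b = refl

countF≡sumF : ∀ {n} (f : Fin n → Bool) → countF f ≡ sumF (𝟙 ∘ f)
countF≡sumF {zero}  f = refl
countF≡sumF {suc n} f = cong (𝟙 (f zero) +_) (countF≡sumF (f ∘ suc))

countF-cong : ∀ {n} {f g : Fin n → Bool} → (∀ k → f k ≡ g k) → countF f ≡ countF g
countF-cong {zero}  f≗g = refl
countF-cong {suc n} f≗g = cong₂ (λ b c → 𝟙 b + c) (f≗g zero) (countF-cong (f≗g ∘ suc))

countF-false : ∀ {n} {f : Fin n → Bool} → (∀ k → f k ≡ false) → countF f ≡ 0
countF-false {zero}  f≗false = refl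
countF-false {suc n} f≗false rewrite f≗false zero = countF-false (f≗false ∘ suc)

countF-↑ : ∀ {m n} (f : Fin (m + n) → Bool) → countF f ≡ countF (f ∘ (_↑ˡ n)) + countF (f ∘ (m ↑ʳ_))
countF-↑ {m} {n} f = begin
  countF f                                         ≡⟨ countF≡sumF f ⟩
  sumF (𝟙 ∘ f)                                     ≡⟨ sumF-↑ {m} (𝟙 ∘ f) ⟩
  sumF (𝟙 ∘ f ∘ (_↑ˡ n)) + sumF (𝟙 ∘ f ∘ (m ↑ʳ_))  ≡⟨ cong₂ _+_ (countF≡sumF (f ∘ (_↑ˡ n)))
                                                               (countF≡sumF (f ∘ (m ↑ʳ_))) ⟨
  countF (f ∘ (_↑ˡ n)) + countF (f ∘ (m ↑ʳ_))      ∎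
  where open ≡-Reasoning

countF-∧-↑ : ∀ {m n} (a b : Fin (m + n) → Bool) {a₁ b₁ : Fin m → Bool} {a₂ b₂ : Fin n → Bool}
           → (∀ s → a (s ↑ˡ n) ≡ a₁ s) → (∀ s → b (s ↑ˡ n) ≡ b₁ s)
           → (∀ t → a (m ↑ʳ t) ≡ a₂ t) → (∀ t → b (m ↑ʳ t) ≡ b₂ t)
           → countF (λ s → a s ∧ b s) ≡ countF (λ s → a₁ s ∧ b₁ s) + countF (λ t → a₂ t ∧ b₂ t)
countF-∧-↑ {m} a b a₁ b₁ a₂ b₂ = trans (countF-↑ {m} _)
  (cong₂ _+_ (countF-cong (λ s → cong₂ _∧_ (a₁ s) (b₁ s)))
             (countF-cong (λ t → cong₂ _∧_ (a₂ t) (b₂ t))))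

sumF-countF-swap : ∀ {m n} (p : Fin m → Fin n → Bool)
                 → sumF (λ i → countF (p i)) ≡ sumF (λ j → countF (λ i → p i j))
sumF-countF-swap p = begin
  sumF (λ i → countF (p i))            ≡⟨ sumF-cong (λ i → countF≡sumF (p i)) ⟩
  sumF (λ i → sumF (λ j → 𝟙 (p i j)))  ≡⟨ sumF-swap (λ i j → 𝟙 (p i j)) ⟩
  sumF (λ j → sumF (λ i → 𝟙 (p i j)))  ≡⟨ sumF-cong (λ j → countF≡sumF (λ i → p i j)) ⟨
  sumF (λ j → countF (λ i → p i j))    ∎
  where open ≡-Reasoning

anyF-cong : ∀ {n} {f g : Fin n → Bool} → (∀ k → f k ≡ g k) → anyF f ≡ anyF g
anyF-cong {zero}  f≗g = refl
anyF-cong {suc n} f≗g = cong₂ _∨_ (f≗g zero) (anyF-cong (f≗g ∘ suc))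

anyF-false : ∀ {n} {f : Fin n → Bool} → (∀ k → f k ≡ false) → anyF f ≡ false
anyF-false {zero}  f≗false = refl
anyF-false {suc n} f≗false rewrite f≗false zero = anyF-false (f≗false ∘ suc)

anyF-true : ∀ {n} {f : Fin n → Bool} k → f k ≡ true → anyF f ≡ true
anyF-true         zero    fk≡true rewrite fk≡true = refl
anyF-true {f = f} (suc k) fk≡true with f zero
... | true  = refl
... | false = anyF-true k fk≡true

anyF-↑ : ∀ {m n} (f : Fin (m + n) → Bool) → anyF f ≡ anyF (f ∘ (_↑ˡ n)) ∨ anyF (f ∘ (m ↑ʳ_))
anyF-↑ {zero}      f = refl
anyF-↑ {suc m} {n} f = trans (cong (f zero ∨_) (anyF-↑ {m} (f ∘ suc))) (sym (∨-assoc (f zero) _ _))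

countF-atMostOne : ∀ {n} (f : Fin n → Bool) → (∀ j k → f j ≡ true → f k ≡ true → j ≡ k)
                 → countF f ≡ 𝟙 (anyF f)
countF-atMostOne {zero}  f unique = refl
countF-atMostOne {suc n} f unique with f zero in f0≡true
... | true  = cong suc (countF-false fsuc≡false)
  where
  fsuc≡false : ∀ k → f (suc k) ≡ false
  fsuc≡false k with f (suc k) in fk≡true
  ... | true  = contradiction (unique zero (suc k) f0≡true fk≡true) (λ ())
  ... | false = refl
... | false = countF-atMostOne (f ∘ suc) (λ j k fj fk → suc-injective (unique (suc j) (suc k) fj fk))

eqᵇ-≡ : ∀ {v} {s t : Fin v} → s ≡ t → eqᵇ s t ≡ true
eqᵇ-≡ {s = s} {t} s≡t with s ≟ t
... | yes _  = refl
... | no s≢t = contradiction s≡t s≢t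

eqᵇ-≢ : ∀ {v} {s t : Fin v} → s ≢ t → eqᵇ s t ≡ false
eqᵇ-≢ {s = s} {t} s≢t with s ≟ t
... | yes s≡t = contradiction s≡t s≢t
... | no _    = refl

eqᵇ⇒≡ : ∀ {v} {s t : Fin v} → eqᵇ s t ≡ true → s ≡ t
eqᵇ⇒≡ {s = s} {t} eq with s ≟ t
eqᵇ⇒≡ _  | yes s≡t = s≡t
eqᵇ⇒≡ () | no _

eqᵇ-injective : ∀ {v w} {f : Fin v → Fin w} → (∀ {s t} → f s ≡ f t → s ≡ t)
              → ∀ s t → eqᵇ (f s) (f t) ≡ eqᵇ s t
eqᵇ-injective f-inj s t with s ≟ t
... | yes refl = eqᵇ-≡ refl
... | no s≢t   = eqᵇ-≢ (s≢t ∘ f-inj)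

countF-eqᵇ : ∀ {v} (t : Fin v) → countF (eqᵇ t) ≡ 1
countF-eqᵇ t = trans (countF-atMostOne (eqᵇ t) (λ _ _ t≡j t≡k → trans (sym (eqᵇ⇒≡ t≡j)) (eqᵇ⇒≡ t≡k)))
                     (cong 𝟙 (anyF-true t (eqᵇ-≡ refl)))

↑ˡ≢↑ʳ : ∀ {m n} (a : Fin m) (b : Fin n) → a ↑ˡ n ≢ m ↑ʳ b
↑ˡ≢↑ʳ {m} {n} a b eq
  with () ← trans (sym (splitAt-↑ˡ m a n)) (trans (cong (splitAt m) eq) (splitAt-↑ʳ m n b))

toℕ-↑ˡ<toℕ-↑ʳ : ∀ {m n} (a : Fin m) (b : Fin n) → toℕ (a ↑ˡ n) < toℕ (m ↑ʳ b)
toℕ-↑ˡ<toℕ-↑ʳ {m} {n} a b =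
  subst₂ _<_ (sym (toℕ-↑ˡ a n)) (sym (toℕ-↑ʳ m b)) (<-≤-trans (toℕ<n a) (m≤m+n m (toℕ b)))

data Split (m n : ℕ) : Fin (m + n) → Set where
  inˡ : ∀ a → Split m n (a ↑ˡ n)
  inʳ : ∀ b → Split m n (m ↑ʳ b)

split : ∀ m n k → Split m n k
split m n k with splitAt m k in eq
... | inj₁ a = subst (Split m n) (splitAt⁻¹-↑ˡ eq) (inˡ a)
... | inj₂ b = subst (Split m n) (splitAt⁻¹-↑ʳ eq) (inʳ b)

ordered-pairs≡C2 : ∀ c → sumF {c} (λ j → sumF {c} (λ j' → if toℕ j <ᵇ toℕ j' then 1 else 0)) ≡ c C 2
ordered-pairs≡C2 zero    = refl
ordered-pairs≡C2 (suc c) = begin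
  sumF {c} (λ _ → 1) + sumF {c} (λ j → sumF {c} (λ j' → if toℕ j <ᵇ toℕ j' then 1 else 0))
                 ≡⟨ cong₂ _+_ (trans (sumF-const c 1) (*-identityʳ c)) (ordered-pairs≡C2 c) ⟩
  c + c C 2      ≡⟨ cong (_+ c C 2) (nC1≡n c) ⟨
  c C 1 + c C 2  ≡⟨ nCk+nC[k+1]≡[n+1]C[k+1] c 1 ⟩
  suc c C 2      ∎
  where open ≡-Reasoning

0<C2 : ∀ {n} → 2 ≤ n → 0 < n C 2
0<C2 {suc (suc n)} (s≤s (s≤s _)) = subst (0 <_) (nCk+nC[k+1]≡[n+1]C[k+1] (suc n) 1)
  (subst (λ k → 0 < k + suc n C 2) (sym (nC1≡n (suc n))) (s≤s z≤n))

module _ {r c v : ℕ} (T : Design r c v) where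

  sumF-repl : sumF (repl T) ≡ r * c
  sumF-repl = begin
    sumF (λ s → sumF (λ i → countF (λ j → eqᵇ (T i j) s)))
      ≡⟨ sumF-swap (λ s i → countF (λ j → eqᵇ (T i j) s)) ⟩
    sumF (λ i → sumF (λ s → countF (λ j → eqᵇ (T i j) s)))
      ≡⟨ sumF-cong (λ i → sumF-countF-swap (λ s j → eqᵇ (T i j) s)) ⟩
    sumF (λ i → sumF (λ j → countF (eqᵇ (T i j))))
      ≡⟨ sumF-cong (λ i → sumF-cong (λ j → countF-eqᵇ (T i j))) ⟩
    sumF {r} (λ _ → sumF {c} (λ _ → 1))
      ≡⟨ sumF-cong {r} (λ _ → trans (sumF-const c 1) (*-identityʳ c)) ⟩
    sumF {r} (λ _ → c)
      ≡⟨ sumF-const r c ⟩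
    r * c
      ∎
    where open ≡-Reasoning

  #rows∋≡repl : Binary T → ∀ s → sumF (λ i → 𝟙 (inRow T i s)) ≡ repl T s
  #rows∋≡repl (row-inj , _) s = sumF-cong (λ i → sym (countF-atMostOne (λ j → eqᵇ (T i j) s)
    (λ j j' Tij≡s Tij'≡s → row-inj i j j' (trans (eqᵇ⇒≡ Tij≡s) (sym (eqᵇ⇒≡ Tij'≡s))))))

  #cols∋≡repl : Binary T → ∀ s → sumF (λ j → 𝟙 (inCol T j s)) ≡ repl T s
  #cols∋≡repl (_ , col-inj) s = trans
    (sumF-cong (λ j → sym (countF-atMostOne (λ i → eqᵇ (T i j) s)
      (λ i i' Tij≡s Ti'j≡s → col-inj i i' j (trans (eqᵇ⇒≡ Tij≡s) (sym (eqᵇ⇒≡ Ti'j≡s)))))))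
    (sym (sumF-countF-swap (λ i j → eqᵇ (T i j) s)))

  Src≡sumF-repl² : Binary T → Src T ≡ sumF (λ s → repl T s * repl T s)
  Src≡sumF-repl² bin = begin
    sumF (λ i → sumF (λ j → countF (λ s → inRow T i s ∧ inCol T j s)))
      ≡⟨ sumF-cong (λ i → sumF-cong (λ j → trans (countF≡sumF (λ s → inRow T i s ∧ inCol T j s))
                                                 (sumF-cong (λ s → 𝟙-∧ (inRow T i s) (inCol T j s))))) ⟩
    sumF (λ i → sumF (λ j → sumF (λ s → 𝟙 (inRow T i s) * 𝟙 (inCol T j s))))
      ≡⟨ sumF-cong (λ i → sumF-swap (λ j s → 𝟙 (inRow T i s) * 𝟙 (inCol T j s))) ⟩
    sumF (λ i → sumF (λ s → sumF (λ j → 𝟙 (inRow T i s) * 𝟙 (inCol T j s))))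
      ≡⟨ sumF-swap (λ i s → sumF (λ j → 𝟙 (inRow T i s) * 𝟙 (inCol T j s))) ⟩
    sumF (λ s → sumF (λ i → sumF (λ j → 𝟙 (inRow T i s) * 𝟙 (inCol T j s))))
      ≡⟨ sumF-cong (λ s → sumF-product (λ i → 𝟙 (inRow T i s)) (λ j → 𝟙 (inCol T j s))) ⟩
    sumF (λ s → sumF (λ i → 𝟙 (inRow T i s)) * sumF (λ j → 𝟙 (inCol T j s)))
      ≡⟨ sumF-cong (λ s → cong₂ _*_ (#rows∋≡repl bin s) (#cols∋≡repl bin s)) ⟩
    sumF (λ s → repl T s * repl T s)
      ∎
    where open ≡-Reasoning

  rcMeet-within : Binary T → (∀ i j → FloorOrCeil (rcMeet T i j) (Src T) (r * c))
                → ∀ m → (∀ s → Between m (suc m) (repl T s)) → ∀ i j → Between m (suc m) (rcMeet T i j)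
  rcMeet-within bin rc m repl∈ i j = floorOrCeil-within m 0<r*c lower upper (rc i j)
    where
    open ≤-Reasoning
    0<r*c : 0 < r * c
    0<r*c = *-mono-< (≤-<-trans z≤n (toℕ<n i)) (≤-<-trans z≤n (toℕ<n j))
    lower : m * (r * c) ≤ Src T
    lower = begin
      m * (r * c)                       ≡⟨ cong (m *_) sumF-repl ⟨
      m * sumF (repl T)                 ≡⟨ sumF-*ˡ m (repl T) ⟨
      sumF (λ s → m * repl T s)         ≤⟨ sumF-mono-≤ (λ s → *-monoˡ-≤ (repl T s) (proj₁ (repl∈ s))) ⟩
      sumF (λ s → repl T s * repl T s)  ≡⟨ Src≡sumF-repl² bin ⟨
      Src T                             ∎
    upper : Src T ≤ suc m * (r * c)
    upper = begin
      Src T                             ≡⟨ Src≡sumF-repl² bin ⟩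
      sumF (λ s → repl T s * repl T s)  ≤⟨ sumF-mono-≤ (λ s → *-monoˡ-≤ (repl T s) (proj₂ (repl∈ s))) ⟩
      sumF (λ s → suc m * repl T s)     ≡⟨ sumF-*ˡ (suc m) (repl T) ⟩
      suc m * sumF (repl T)             ≡⟨ cong (suc m *_) sumF-repl ⟩
      suc m * (r * c)                   ∎

  ccMeet-sym : ∀ j j' → ccMeet T j j' ≡ ccMeet T j' j
  ccMeet-sym j j' = countF-cong (λ s → ∧-comm (inCol T j s) (inCol T j' s))

  ccMeet≤1 : 2 ≤ c → Scc T ≤ c C 2 → (∀ j j' → j ≢ j' → FloorOrCeil (ccMeet T j j') (Scc T) (c C 2))
           → ∀ j j' → j ≢ j' → ccMeet T j j' ≤ 1
  ccMeet≤1 c≥2 Scc≤C2 cc j j' j≢j' = proj₂ (floorOrCeil-within 0 (0<C2 c≥2) z≤n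
    (subst (Scc T ≤_) (sym (+-identityʳ (c C 2))) Scc≤C2) (cc j j' j≢j'))

  ccMeet≤Scc-ordered : ∀ {j j'} → toℕ j < toℕ j' → ccMeet T j j' ≤ Scc T
  ccMeet≤Scc-ordered {j} {j'} j<j' = ≤-trans term (≤-trans (≤-sumF _ j') (≤-sumF _ j))
    where
    term : ccMeet T j j' ≤ (if toℕ j <ᵇ toℕ j' then ccMeet T j j' else 0)
    term with toℕ j <ᵇ toℕ j' | <⇒<ᵇ j<j'
    ... | true  | _  = ≤-refl
    ... | false | ()

  ccMeet≤Scc : ∀ {j j'} → j ≢ j' → ccMeet T j j' ≤ Scc T
  ccMeet≤Scc {j} {j'} j≢j' with <-cmp (toℕ j) (toℕ j')
  ... | tri< j<j' _ _ = ccMeet≤Scc-ordered j<j'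
  ... | tri≈ _ j≡j' _ = contradiction (toℕ-injective j≡j') j≢j'
  ... | tri> _ _ j>j' = subst (_≤ Scc T) (ccMeet-sym j' j) (ccMeet≤Scc-ordered j>j')

  Scc<C2 : (∀ j j' → j ≢ j' → ccMeet T j j' ≤ 1)
         → ∀ {j j'} → toℕ j < toℕ j' → ccMeet T j j' ≡ 0 → Scc T < c C 2
  Scc<C2 meet≤1 {j} {j'} j<j' disjoint = subst (Scc T <_) (ordered-pairs≡C2 c)
    (sumF-mono-< (λ a → sumF-mono-≤ (bounded a)) j (sumF-mono-< (bounded j) j' strict))
    where
    bounded : ∀ a b → (if toℕ a <ᵇ toℕ b then ccMeet T a b else 0) ≤ (if toℕ a <ᵇ toℕ b then 1 else 0)
    bounded a b with toℕ a <ᵇ toℕ b | <ᵇ⇒< (toℕ a) (toℕ b)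
    ... | true  | a<b = meet≤1 a b (<⇒≢ (a<b _) ∘ cong toℕ)
    ... | false | _   = z≤n
    strict : (if toℕ j <ᵇ toℕ j' then ccMeet T j j' else 0) < (if toℕ j <ᵇ toℕ j' then 1 else 0)
    strict with toℕ j <ᵇ toℕ j' | <⇒<ᵇ j<j'
    ... | true  | _  = subst (_< 1) (sym disjoint) (s≤s z≤n)
    ... | false | ()

module Juxtaposition {r c₁ c₂ v₁ v₂ : ℕ} (T₁ : Design r c₁ v₁) (T₂ : Design r c₂ v₂) where

  T : Design r (c₁ + c₂) (v₁ + v₂)
  T = juxtapose T₁ T₂

  T-↑ˡ : ∀ i j → T i (j ↑ˡ c₂) ≡ T₁ i j ↑ˡ v₂
  T-↑ˡ i j rewrite splitAt-↑ˡ c₁ j c₂ = refl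

  T-↑ʳ : ∀ i j → T i (c₁ ↑ʳ j) ≡ v₁ ↑ʳ T₂ i j
  T-↑ʳ i j rewrite splitAt-↑ʳ c₁ c₂ j = refl

  eqᵇ-T-↑ˡ-↑ˡ : ∀ i j s → eqᵇ (T i (j ↑ˡ c₂)) (s ↑ˡ v₂) ≡ eqᵇ (T₁ i j) s
  eqᵇ-T-↑ˡ-↑ˡ i j s =
    trans (cong (λ u → eqᵇ u (s ↑ˡ v₂)) (T-↑ˡ i j)) (eqᵇ-injective (↑ˡ-injective v₂ _ _) (T₁ i j) s)

  eqᵇ-T-↑ˡ-↑ʳ : ∀ i j t → eqᵇ (T i (j ↑ˡ c₂)) (v₁ ↑ʳ t) ≡ false
  eqᵇ-T-↑ˡ-↑ʳ i j t = trans (cong (λ u → eqᵇ u (v₁ ↑ʳ t)) (T-↑ˡ i j)) (eqᵇ-≢ (↑ˡ≢↑ʳ (T₁ i j) t))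

  eqᵇ-T-↑ʳ-↑ˡ : ∀ i j s → eqᵇ (T i (c₁ ↑ʳ j)) (s ↑ˡ v₂) ≡ false
  eqᵇ-T-↑ʳ-↑ˡ i j s = trans (cong (λ u → eqᵇ u (s ↑ˡ v₂)) (T-↑ʳ i j)) (eqᵇ-≢ (↑ˡ≢↑ʳ s (T₂ i j) ∘ sym))

  eqᵇ-T-↑ʳ-↑ʳ : ∀ i j t → eqᵇ (T i (c₁ ↑ʳ j)) (v₁ ↑ʳ t) ≡ eqᵇ (T₂ i j) t
  eqᵇ-T-↑ʳ-↑ʳ i j t =
    trans (cong (λ u → eqᵇ u (v₁ ↑ʳ t)) (T-↑ʳ i j)) (eqᵇ-injective (↑ʳ-injective v₁ _ _) (T₂ i j) t)

  inRow-↑ˡ : ∀ i s → inRow T i (s ↑ˡ v₂) ≡ inRow T₁ i s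
  inRow-↑ˡ i s = trans (anyF-↑ {c₁} _) (trans
    (cong₂ _∨_ (anyF-cong (λ j → eqᵇ-T-↑ˡ-↑ˡ i j s)) (anyF-false (λ j → eqᵇ-T-↑ʳ-↑ˡ i j s)))
    (∨-identityʳ _))

  inRow-↑ʳ : ∀ i t → inRow T i (v₁ ↑ʳ t) ≡ inRow T₂ i t
  inRow-↑ʳ i t = trans (anyF-↑ {c₁} _)
    (cong₂ _∨_ (anyF-false (λ j → eqᵇ-T-↑ˡ-↑ʳ i j t)) (anyF-cong (λ j → eqᵇ-T-↑ʳ-↑ʳ i j t)))

  inCol-↑ˡ-↑ˡ : ∀ j s → inCol T (j ↑ˡ c₂) (s ↑ˡ v₂) ≡ inCol T₁ j s
  inCol-↑ˡ-↑ˡ j s = anyF-cong (λ i → eqᵇ-T-↑ˡ-↑ˡ i j s)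

  inCol-↑ˡ-↑ʳ : ∀ j t → inCol T (j ↑ˡ c₂) (v₁ ↑ʳ t) ≡ false
  inCol-↑ˡ-↑ʳ j t = anyF-false (λ i → eqᵇ-T-↑ˡ-↑ʳ i j t)

  inCol-↑ʳ-↑ˡ : ∀ j s → inCol T (c₁ ↑ʳ j) (s ↑ˡ v₂) ≡ false
  inCol-↑ʳ-↑ˡ j s = anyF-false (λ i → eqᵇ-T-↑ʳ-↑ˡ i j s)

  inCol-↑ʳ-↑ʳ : ∀ j t → inCol T (c₁ ↑ʳ j) (v₁ ↑ʳ t) ≡ inCol T₂ j t
  inCol-↑ʳ-↑ʳ j t = anyF-cong (λ i → eqᵇ-T-↑ʳ-↑ʳ i j t)

  repl-↑ˡ : ∀ s → repl T (s ↑ˡ v₂) ≡ repl T₁ s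
  repl-↑ˡ s = sumF-cong (λ i → trans (countF-↑ {c₁} _) (trans
    (cong₂ _+_ (countF-cong (λ j → eqᵇ-T-↑ˡ-↑ˡ i j s)) (countF-false (λ j → eqᵇ-T-↑ʳ-↑ˡ i j s)))
    (+-identityʳ _)))

  repl-↑ʳ : ∀ t → repl T (v₁ ↑ʳ t) ≡ repl T₂ t
  repl-↑ʳ t = sumF-cong (λ i → trans (countF-↑ {c₁} _)
    (cong₂ _+_ (countF-false (λ j → eqᵇ-T-↑ˡ-↑ʳ i j t)) (countF-cong (λ j → eqᵇ-T-↑ʳ-↑ʳ i j t))))

  rcMeet-↑ˡ : ∀ i j → rcMeet T i (j ↑ˡ c₂) ≡ rcMeet T₁ i j
  rcMeet-↑ˡ i j = trans
    (countF-∧-↑ {v₁} (inRow T i) (inCol T (j ↑ˡ c₂))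
                (inRow-↑ˡ i) (inCol-↑ˡ-↑ˡ j) (inRow-↑ʳ i) (inCol-↑ˡ-↑ʳ j))
    (trans (cong (rcMeet T₁ i j +_) (countF-false (λ t → ∧-zeroʳ (inRow T₂ i t)))) (+-identityʳ _))

  rcMeet-↑ʳ : ∀ i j → rcMeet T i (c₁ ↑ʳ j) ≡ rcMeet T₂ i j
  rcMeet-↑ʳ i j = trans
    (countF-∧-↑ {v₁} (inRow T i) (inCol T (c₁ ↑ʳ j))
                (inRow-↑ˡ i) (inCol-↑ʳ-↑ˡ j) (inRow-↑ʳ i) (inCol-↑ʳ-↑ʳ j))
    (cong (_+ rcMeet T₂ i j) (countF-false (λ s → ∧-zeroʳ (inRow T₁ i s))))

  rrMeet-+ : ∀ i i' → rrMeet T i i' ≡ rrMeet T₁ i i' + rrMeet T₂ i i'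
  rrMeet-+ i i' = countF-∧-↑ {v₁} (inRow T i) (inRow T i')
                               (inRow-↑ˡ i) (inRow-↑ˡ i') (inRow-↑ʳ i) (inRow-↑ʳ i')

  ccMeet-↑ˡ-↑ˡ : ∀ j j' → ccMeet T (j ↑ˡ c₂) (j' ↑ˡ c₂) ≡ ccMeet T₁ j j'
  ccMeet-↑ˡ-↑ˡ j j' = trans
    (countF-∧-↑ {v₁} (inCol T (j ↑ˡ c₂)) (inCol T (j' ↑ˡ c₂))
                (inCol-↑ˡ-↑ˡ j) (inCol-↑ˡ-↑ˡ j') (inCol-↑ˡ-↑ʳ j) (inCol-↑ˡ-↑ʳ j'))
    (trans (cong (ccMeet T₁ j j' +_) (countF-false {v₂} (λ _ → refl))) (+-identityʳ _))

  ccMeet-↑ʳ-↑ʳ : ∀ j j' → ccMeet T (c₁ ↑ʳ j) (c₁ ↑ʳ j') ≡ ccMeet T₂ j j'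
  ccMeet-↑ʳ-↑ʳ j j' = trans
    (countF-∧-↑ {v₁} (inCol T (c₁ ↑ʳ j)) (inCol T (c₁ ↑ʳ j'))
                (inCol-↑ʳ-↑ˡ j) (inCol-↑ʳ-↑ˡ j') (inCol-↑ʳ-↑ʳ j) (inCol-↑ʳ-↑ʳ j'))
    (cong (_+ ccMeet T₂ j j') (countF-false {v₁} (λ _ → refl)))

  ccMeet-↑ˡ-↑ʳ : ∀ j j' → ccMeet T (j ↑ˡ c₂) (c₁ ↑ʳ j') ≡ 0
  ccMeet-↑ˡ-↑ʳ j j' = trans
    (countF-∧-↑ {v₁} (inCol T (j ↑ˡ c₂)) (inCol T (c₁ ↑ʳ j'))
                (inCol-↑ˡ-↑ˡ j) (inCol-↑ʳ-↑ˡ j') (inCol-↑ˡ-↑ʳ j) (inCol-↑ʳ-↑ʳ j'))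
    (cong₂ _+_ (countF-false (λ s → ∧-zeroʳ (inCol T₁ j s))) (countF-false {v₂} (λ _ → refl)))

  Srr-+ : Srr T ≡ Srr T₁ + Srr T₂
  Srr-+ = begin
    Srr T
      ≡⟨ sumF-cong (λ i → sumF-cong (λ i' → if-+ (toℕ i <ᵇ toℕ i') (rrMeet-+ i i'))) ⟩
    sumF (λ i → sumF (λ i' → f₁ i i' + f₂ i i'))
      ≡⟨ sumF-cong (λ i → sumF-+ (f₁ i) (f₂ i)) ⟩
    sumF (λ i → sumF (f₁ i) + sumF (f₂ i))
      ≡⟨ sumF-+ (λ i → sumF (f₁ i)) (λ i → sumF (f₂ i)) ⟩
    Srr T₁ + Srr T₂
      ∎
    where
    open ≡-Reasoning
    f₁ f₂ : Fin r → Fin r → ℕ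
    f₁ i i' = if toℕ i <ᵇ toℕ i' then rrMeet T₁ i i' else 0
    f₂ i i' = if toℕ i <ᵇ toℕ i' then rrMeet T₂ i i' else 0
    if-+ : ∀ b {x y z} → x ≡ y + z → (if b then x else 0) ≡ (if b then y else 0) + (if b then z else 0)
    if-+ true  x≡y+z = x≡y+z
    if-+ false _     = refl

  binary : Binary T₁ → Binary T₂ → Binary T
  binary (row-inj₁ , col-inj₁) (row-inj₂ , col-inj₂) = row-inj , col-inj
    where
    row-inj : ∀ i j j' → T i j ≡ T i j' → j ≡ j'
    row-inj i j j' eq with split c₁ c₂ j | split c₁ c₂ j'
    ... | inˡ a | inˡ b = cong (_↑ˡ c₂) (row-inj₁ i a b
                            (↑ˡ-injective v₂ _ _ (trans (sym (T-↑ˡ i a)) (trans eq (T-↑ˡ i b)))))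
    ... | inˡ a | inʳ b = contradiction (trans (sym (T-↑ˡ i a)) (trans eq (T-↑ʳ i b))) (↑ˡ≢↑ʳ _ _)
    ... | inʳ a | inˡ b = contradiction (trans (sym (T-↑ˡ i b)) (trans (sym eq) (T-↑ʳ i a))) (↑ˡ≢↑ʳ _ _)
    ... | inʳ a | inʳ b = cong (c₁ ↑ʳ_) (row-inj₂ i a b
                            (↑ʳ-injective v₁ _ _ (trans (sym (T-↑ʳ i a)) (trans eq (T-↑ʳ i b)))))
    col-inj : ∀ i i' j → T i j ≡ T i' j → i ≡ i'
    col-inj i i' j eq with split c₁ c₂ j
    ... | inˡ a = col-inj₁ i i' a (↑ˡ-injective v₂ _ _ (trans (sym (T-↑ˡ i a)) (trans eq (T-↑ˡ i' a))))
    ... | inʳ a = col-inj₂ i i' a (↑ʳ-injective v₁ _ _ (trans (sym (T-↑ʳ i a)) (trans eq (T-↑ʳ i' a))))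

  repl-within : ∀ {m} → (∀ s → Between m (suc m) (repl T₁ s)) → (∀ t → Between m (suc m) (repl T₂ t))
              → ∀ s → Between m (suc m) (repl T s)
  repl-within {m} repl₁∈ repl₂∈ s with split v₁ v₂ s
  ... | inˡ a = subst (Between m (suc m)) (sym (repl-↑ˡ a)) (repl₁∈ a)
  ... | inʳ b = subst (Between m (suc m)) (sym (repl-↑ʳ b)) (repl₂∈ b)

  rcMeet-within-juxtapose : ∀ {m} → (∀ i j → Between m (suc m) (rcMeet T₁ i j))
                          → (∀ i j → Between m (suc m) (rcMeet T₂ i j))
                          → ∀ i j → Between m (suc m) (rcMeet T i j)
  rcMeet-within-juxtapose {m} rc₁∈ rc₂∈ i j with split c₁ c₂ j
  ... | inˡ a = subst (Between m (suc m)) (sym (rcMeet-↑ˡ i a)) (rc₁∈ i a)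
  ... | inʳ b = subst (Between m (suc m)) (sym (rcMeet-↑ʳ i b)) (rc₂∈ i b)

  ccMeet≤1-juxtapose : (∀ j j' → j ≢ j' → ccMeet T₁ j j' ≤ 1) → (∀ j j' → j ≢ j' → ccMeet T₂ j j' ≤ 1)
                     → ∀ j j' → j ≢ j' → ccMeet T j j' ≤ 1
  ccMeet≤1-juxtapose cc₁≤1 cc₂≤1 j j' j≢j' with split c₁ c₂ j | split c₁ c₂ j'
  ... | inˡ a | inˡ b = subst (_≤ 1) (sym (ccMeet-↑ˡ-↑ˡ a b)) (cc₁≤1 a b (j≢j' ∘ cong (_↑ˡ c₂)))
  ... | inˡ a | inʳ b = subst (_≤ 1) (sym (ccMeet-↑ˡ-↑ʳ a b)) z≤n
  ... | inʳ a | inˡ b = subst (_≤ 1) (sym (trans (ccMeet-sym T (c₁ ↑ʳ a) (b ↑ˡ c₂)) (ccMeet-↑ˡ-↑ʳ b a))) z≤n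
  ... | inʳ a | inʳ b = subst (_≤ 1) (sym (ccMeet-↑ʳ-↑ʳ a b)) (cc₂≤1 a b (j≢j' ∘ cong (c₁ ↑ʳ_)))

  Scc<C2-juxtapose : Fin c₁ → Fin c₂ → (∀ j j' → j ≢ j' → ccMeet T j j' ≤ 1) → Scc T < (c₁ + c₂) C 2
  Scc<C2-juxtapose a b ccT≤1 = Scc<C2 T ccT≤1 (toℕ-↑ˡ<toℕ-↑ʳ a b) (ccMeet-↑ˡ-↑ʳ a b)

lemma5p6 : ∀ {r c₁ c₂ v₁ v₂ : ℕ} (T₁ : Design r c₁ v₁) (T₂ : Design r c₂ v₂)
    → NearTripleArray T₁ → NearTripleArray T₂
    → ceilDiv (r * c₁) v₁ ⊔ ceilDiv (r * c₂) v₂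
        ≤ (floorDiv (r * c₁) v₁ ⊓ floorDiv (r * c₂) v₂) + 1
    → (r C 2) ∣ Srr T₁ ⊎ (r C 2) ∣ Srr T₂
    → Scc T₁ ≤ c₁ C 2 × Scc T₂ ≤ c₂ C 2
    → NearTripleArray (juxtapose T₁ T₂)
lemma5p6 {r} {c₁} {c₂} {v₁} {v₂} T₁ T₂
         (r≥2 , c₁≥2 , bin₁ , ne₁ , rc₁ , rr₁ , cc₁) (_ , c₂≥2 , bin₂ , ne₂ , rc₂ , rr₂ , cc₂)
         ceil≤floor+1 C2∣Srr (Scc₁≤C2 , Scc₂≤C2) =
  r≥2 , ≤-trans c₁≥2 (m≤m+n c₁ c₂) , binary bin₁ bin₂ , nearEquireplicate , rcMeet-fc , rrMeet-fc , ccMeet-fc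
  where
  open Juxtaposition T₁ T₂
  m : ℕ
  m = floorDiv (r * c₁) v₁ ⊓ floorDiv (r * c₂) v₂
  ceil≤1+m : ceilDiv (r * c₁) v₁ ⊔ ceilDiv (r * c₂) v₂ ≤ suc m
  ceil≤1+m = ≤-trans ceil≤floor+1 (≤-reflexive (+-comm m 1))
  repl₁∈ : ∀ s → Between m (suc m) (repl T₁ s)
  repl₁∈ s = floorOrCeil-between (r * c₁) v₁ (m⊓n≤m _ _) (≤-trans (m≤m⊔n _ _) ceil≤1+m) (ne₁ s)
  repl₂∈ : ∀ t → Between m (suc m) (repl T₂ t)
  repl₂∈ t = floorOrCeil-between (r * c₂) v₂ (m⊓n≤n _ _) (≤-trans (m≤n⊔m _ _) ceil≤1+m) (ne₂ t)
  nearEquireplicate : NearEquireplicate T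
  nearEquireplicate s = subst (λ S → FloorOrCeil (repl T s) S (v₁ + v₂)) (sumF-repl T)
    (floorOrCeil-mean (repl T) m (repl-within repl₁∈ repl₂∈) s)
  rcMeet-fc : ∀ i j → FloorOrCeil (rcMeet T i j) (Src T) (r * (c₁ + c₂))
  rcMeet-fc = floorOrCeil-mean₂ (rcMeet T) m
    (rcMeet-within-juxtapose (rcMeet-within T₁ bin₁ rc₁ m repl₁∈) (rcMeet-within T₂ bin₂ rc₂ m repl₂∈))
  rrMeet-fc : ∀ i i' → i ≢ i' → FloorOrCeil (rrMeet T i i') (Srr T) (r C 2)
  rrMeet-fc i i' i≢i' = subst₂ (λ x S → FloorOrCeil x S (r C 2)) (sym (rrMeet-+ i i')) (sym Srr-+)
    (floorOrCeil-+ (0<C2 r≥2) C2∣Srr (rr₁ i i' i≢i') (rr₂ i i' i≢i'))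
  ccT≤1 : ∀ j j' → j ≢ j' → ccMeet T j j' ≤ 1
  ccT≤1 = ccMeet≤1-juxtapose (ccMeet≤1 T₁ c₁≥2 Scc₁≤C2 cc₁) (ccMeet≤1 T₂ c₂≥2 Scc₂≤C2 cc₂)
  ccMeet-fc : ∀ j j' → j ≢ j' → FloorOrCeil (ccMeet T j j') (Scc T) ((c₁ + c₂) C 2)
  ccMeet-fc j j' j≢j' = floorOrCeil-≤1 (ccT≤1 j j' j≢j') (ccMeet≤Scc T j≢j')
    (Scc<C2-juxtapose (fromℕ< (≤-trans (s≤s z≤n) c₁≥2)) (fromℕ< (≤-trans (s≤s z≤n) c₂≥2)) ccT≤1)
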